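{- There exists a lattice $M$ in the variety $\mathcal{M}_{3,3}$ such that the canonical embedding $M\to\mathrm{Id}\,M$, $x\mapsto\{y\in M: y\leq x\}$, is not pure.
   Context: $\mathsf{M}_{3,3}$ is the eight-element modular lattice $\{0,u,v_0,v_1,v,u_0,u_1,1\}$ obtained by gluing two copies of $\mathsf{M}_3$ along a prime interval: $\{0,u,v_0,v_1,v\}$ is an $\mathsf{M}_3$ with bottom $0$, atoms $u,v_0,v_1$ and top $v$, and $\{u,v,u_0,u_1,1\}$ is an $\mathsf{M}_3$ with bottom $u$, atoms $v,u_0,u_1$ and top $1$. $\mathcal{M}_{3,3}$ is the lattice variety generated by $\mathsf{M}_{3,3}$. An ideal of a lattice $M$ is a nonempty subset $I$ with $x\vee y\in I$ iff $x,y\in I$; $\mathrm{Id}\,M$ is the lattice of ideals under inclusion. A subalgebra $A$ of an algebra $B$ is pure in $B$ if every finite system of equations with parameters from $A$ that has a solution in $B$ also has a solution in $A$; an embedding $f\colon A\to B$ is pure if $f[A]$ is a pure subalgebra of $B$. -}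

module Defs where

open import Level using (0ℓ)
open import Algebra.Lattice.Bundles using (Lattice)
open import Data.Nat using (ℕ)
open import Data.Fin using (Fin)
open import Data.List using (List)
open import Data.List.Relation.Unary.All using (All)
open import Data.Product using (_×_; _,_; Σ; ∃)
open import Data.Sum using (_⊎_; [_,_])
open import Relation.Binary.PropositionalEquality using (_≡_)
open import Relation.Unary using (Pred; _≐_)
open import Function.Bundles using (_⇔_)

-- Lattice terms over a set X of variables (and, when X = V ⊎ A,
-- parameters from A).

infixr 6 _∨ₜ_
infixr 7 _∧ₜ_

data Term (X : Set) : Set where
  var   : X → Term X
  _∨ₜ_  : Term X → Term X → Term X
  _∧ₜ_  : Term X → Term X → Term X

-- The eight-element lattice M_{3,3}:
--   {𝟎,u,v₀,v₁,v} is an M3 with bottom 𝟎, atoms u v₀ v₁, top v;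
--   {u,v,u₀,u₁,𝟏} is an M3 with bottom u, atoms v u₀ u₁, top 𝟏.

data M33 : Set where
  𝟎 u v₀ v₁ v u₀ u₁ 𝟏 : M33

infixr 6 _⊔_
infixr 7 _⊓_

_⊔_ : M33 → M33 → M33
𝟎  ⊔ y  = y
𝟏  ⊔ y  = 𝟏
u  ⊔ 𝟎  = u
u  ⊔ u  = u
u  ⊔ v₀ = v
u  ⊔ v₁ = v
u  ⊔ v  = v
u  ⊔ u₀ = u₀
u  ⊔ u₁ = u₁
u  ⊔ 𝟏  = 𝟏
v₀ ⊔ 𝟎  = v₀
v₀ ⊔ u  = v
v₀ ⊔ v₀ = v₀
v₀ ⊔ v₁ = v
v₀ ⊔ v  = v
v₀ ⊔ u₀ = 𝟏
v₀ ⊔ u₁ = 𝟏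
v₀ ⊔ 𝟏  = 𝟏
v₁ ⊔ 𝟎  = v₁
v₁ ⊔ u  = v
v₁ ⊔ v₀ = v
v₁ ⊔ v₁ = v₁
v₁ ⊔ v  = v
v₁ ⊔ u₀ = 𝟏
v₁ ⊔ u₁ = 𝟏
v₁ ⊔ 𝟏  = 𝟏
v  ⊔ 𝟎  = v
v  ⊔ u  = v
v  ⊔ v₀ = v
v  ⊔ v₁ = v
v  ⊔ v  = v
v  ⊔ u₀ = 𝟏
v  ⊔ u₁ = 𝟏
v  ⊔ 𝟏  = 𝟏
u₀ ⊔ 𝟎  = u₀
u₀ ⊔ u  = u₀
u₀ ⊔ u₀ = u₀
u₀ ⊔ _  = 𝟏
u₁ ⊔ 𝟎  = u₁
u₁ ⊔ u  = u₁
u₁ ⊔ u₁ = u₁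
u₁ ⊔ _  = 𝟏

_⊓_ : M33 → M33 → M33
𝟏  ⊓ y  = y
𝟎  ⊓ y  = 𝟎
u  ⊓ 𝟏  = u
u  ⊓ u  = u
u  ⊓ v  = u
u  ⊓ u₀ = u
u  ⊓ u₁ = u
u  ⊓ _  = 𝟎
v₀ ⊓ 𝟏  = v₀
v₀ ⊓ v₀ = v₀
v₀ ⊓ v  = v₀
v₀ ⊓ _  = 𝟎
v₁ ⊓ 𝟏  = v₁
v₁ ⊓ v₁ = v₁
v₁ ⊓ v  = v₁
v₁ ⊓ _  = 𝟎
v  ⊓ 𝟏  = v
v  ⊓ v  = v
v  ⊓ v₀ = v₀
v  ⊓ v₁ = v₁
v  ⊓ u  = u
v  ⊓ u₀ = u
v  ⊓ u₁ = u
v  ⊓ 𝟎  = 𝟎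
u₀ ⊓ 𝟏  = u₀
u₀ ⊓ u₀ = u₀
u₀ ⊓ u  = u
u₀ ⊓ v  = u
u₀ ⊓ u₁ = u
u₀ ⊓ _  = 𝟎
u₁ ⊓ 𝟏  = u₁
u₁ ⊓ u₁ = u₁
u₁ ⊓ u  = u
u₁ ⊓ v  = u
u₁ ⊓ u₀ = u
u₁ ⊓ _  = 𝟎

eval₃₃ : (ℕ → M33) → Term ℕ → M33
eval₃₃ ρ (var x)  = ρ x
eval₃₃ ρ (s ∨ₜ t) = eval₃₃ ρ s ⊔ eval₃₃ ρ t
eval₃₃ ρ (s ∧ₜ t) = eval₃₃ ρ s ⊓ eval₃₃ ρ t

module _ (L : Lattice 0ℓ 0ℓ) where
  open Lattice L

  evalL : {X : Set} → (X → Carrier) → Term X → Carrier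
  evalL ρ (var x)  = ρ x
  evalL ρ (s ∨ₜ t) = evalL ρ s ∨ evalL ρ t
  evalL ρ (s ∧ₜ t) = evalL ρ s ∧ evalL ρ t

  -- L belongs to the variety 𝓜₃,₃ generated by M₃,₃: L satisfies every
  -- lattice identity that holds in M₃,₃ (Birkhoff: V(K) = Mod(Id(K))).
  InM33Variety : Set
  InM33Variety = (s t : Term ℕ) →
    ((ρ : ℕ → M33) → eval₃₃ ρ s ≡ eval₃₃ ρ t) →
    (ρ : ℕ → Carrier) → evalL ρ s ≈ evalL ρ t

  _≼_ : Carrier → Carrier → Set
  x ≼ y = (x ∨ y) ≈ y

  record Ideal : Set₁ where
    field
      mem      : Pred Carrier 0ℓ
      resp     : ∀ {x y} → x ≈ y → mem x → mem y
      nonempty : ∃ mem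
      closed   : ∀ x y → mem (x ∨ y) ⇔ (mem x × mem y)
  open Ideal public

  -- principal ideal ↓x = { y ∈ L : y ≤ x }  (the canonical embedding L → Id L)
  ↓ : Carrier → Pred Carrier 0ℓ
  ↓ x y = y ≼ x

  -- Operations of Id L on (membership predicates of) ideals:
  -- meet is intersection, join is the ideal generated by the union.
  _∩ᵢ_ : Pred Carrier 0ℓ → Pred Carrier 0ℓ → Pred Carrier 0ℓ
  (P ∩ᵢ Q) x = P x × Q x

  _∪ᵢ_ : Pred Carrier 0ℓ → Pred Carrier 0ℓ → Pred Carrier 0ℓ
  (P ∪ᵢ Q) x = Σ Carrier λ a → Σ Carrier λ b → P a × Q b × (x ≼ (a ∨ b))

  evalId : {X : Set} → (X → Pred Carrier 0ℓ) → Term X → Pred Carrier 0ℓ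
  evalId ρ (var x)  = ρ x
  evalId ρ (s ∨ₜ t) = evalId ρ s ∪ᵢ evalId ρ t
  evalId ρ (s ∧ₜ t) = evalId ρ s ∩ᵢ evalId ρ t

  System : ℕ → Set
  System n = List (Term (Fin n ⊎ Carrier) × Term (Fin n ⊎ Carrier))

  HoldsInId : {n : ℕ} → (Fin n → Pred Carrier 0ℓ) → System n → Set
  HoldsInId env sys =
    All (λ { (s , t) → evalId [ env , ↓ ] s ≐ evalId [ env , ↓ ] t }) sys

  SolvableInId : {n : ℕ} → System n → Set₁
  SolvableInId {n} sys = Σ (Fin n → Ideal) λ ρ → HoldsInId (λ i → mem (ρ i)) sys

  SolvableInImage : {n : ℕ} → System n → Set
  SolvableInImage {n} sys = Σ (Fin n → Carrier) λ ρ → HoldsInId (λ i → ↓ (ρ i)) sys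

  CanonicalEmbeddingPure : Set₁
  CanonicalEmbeddingPure = (n : ℕ) (sys : System n) →
    SolvableInId sys → SolvableInImage sys

module Submission where

-- Let R ⊆ M₃,₃² be the sublattice of pairs (a , b) with floor a ≤ b ≤ swap a,
-- where swap exchanges u₀ and u₁ and floor a is u above ↓v and 0 inside it.
-- M is the lattice of eventually constant sequences x : ℕ → M₃,₃ with
-- (x k , x (k+1)) ∈ R for all k; as a sublattice of M₃,₃^ℕ it lies in 𝓜₃,₃.
-- The system in unknowns X, Y with constant parameters c₀ = v₀, c₁ = v₁ and
-- parameters d = (v,0,0,…), e = (u,0,0,…)
--     (X ∨ c₀) ∧ c₁ = (X ∨ Y) ∧ c₁,   c₀ ∧ Y = Y ∧ c₁,   X ∧ d = e
-- is solved in Id M by the ideals generated by the increasing chains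
-- xₙ = (u₀ u₁)ⁿ⁺¹ u 0 0 … and yₙ = swap ∘ xₙ.  In M itself the equations
-- force x(0) ∈ {u₀,u₁} and propagate this along R, so x never becomes
-- constant, as R has no loop at u₀ or u₁.

open import Defs
open import Level using (0ℓ)
open import Algebra.Lattice.Bundles using (Lattice)
open import Algebra.Lattice.Structures using (IsLattice)
import Algebra.Lattice.Properties.Lattice as LatticeProperties
import Relation.Binary.Lattice as OrderTheoretic
import Relation.Binary.Lattice.Properties.JoinSemilattice as JoinProperties
import Relation.Binary.Lattice.Properties.MeetSemilattice as MeetProperties
open import Data.Nat as ℕ using (ℕ; zero; suc; _+_; _≤′_; ≤′-refl; ≤′-step; s≤s)
import Data.Nat.Properties as ℕ
open import Data.Fin using (Fin) renaming (zero to fzero; suc to fsuc)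
open import Data.List using (List; []; _∷_)
open import Data.List.Relation.Unary.All as All using (All; []; _∷_; all?)
open import Data.List.Relation.Unary.Any using (here; there)
open import Data.List.Membership.Propositional using (_∈_)
open import Data.Product using (Σ; _×_; _,_; proj₁; proj₂)
open import Data.Empty using (⊥)
open import Data.Sum using (_⊎_; inj₁; inj₂; [_,_])
open import Function using (id; _∘_)
open import Function.Bundles using (mk⇔)
open import Relation.Binary.Definitions using (DecidableEquality)
open import Relation.Binary.PropositionalEquality
  using (_≡_; refl; sym; trans; cong; cong₂; subst)
open import Relation.Nullary using (Dec; ¬_)
open import Relation.Nullary.Decidable
  using (map′; from-yes; _×-dec_; _⊎-dec_; _→-dec_; ¬?)
open import Relation.Unary using (Pred; Decidable; _≐_)
open import Relation.Unary.Properties using (≐-refl; ≐-sym; ≐-trans)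

code : M33 → ℕ
code 𝟎  = 0
code u  = 1
code v₀ = 2
code v₁ = 3
code v  = 4
code u₀ = 5
code u₁ = 6
code 𝟏  = 7

decode : ℕ → M33
decode 0 = 𝟎
decode 1 = u
decode 2 = v₀
decode 3 = v₁
decode 4 = v
decode 5 = u₀
decode 6 = u₁
decode _ = 𝟏

decode-code : ∀ a → decode (code a) ≡ a
decode-code 𝟎  = refl
decode-code u  = refl
decode-code v₀ = refl
decode-code v₁ = refl
decode-code v  = refl
decode-code u₀ = refl
decode-code u₁ = refl
decode-code 𝟏  = refl

infix 4 _≟_
_≟_ : DecidableEquality M33
a ≟ b = map′ injective (cong code) (code a ℕ.≟ code b)
  where
  injective : code a ≡ code b → a ≡ b
  injective p = trans (sym (decode-code a)) (trans (cong decode p) (decode-code b))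

elements : List M33
elements = 𝟎 ∷ u ∷ v₀ ∷ v₁ ∷ v ∷ u₀ ∷ u₁ ∷ 𝟏 ∷ []

∈-elements : ∀ a → a ∈ elements
∈-elements 𝟎  = here refl
∈-elements u  = there (here refl)
∈-elements v₀ = there (there (here refl))
∈-elements v₁ = there (there (there (here refl)))
∈-elements v  = there (there (there (there (here refl))))
∈-elements u₀ = there (there (there (there (there (here refl)))))
∈-elements u₁ = there (there (there (there (there (there (here refl))))))
∈-elements 𝟏  = there (there (there (there (there (there (there (here refl)))))))

-- Every statement `∀ a → P a` with P decidable is decidable.  Below, finite
-- facts are proved as `from-yes (decision)`, which typechecks exactly when
-- the decision evaluates to yes.
∀? : {P : M33 → Set} → Decidable P → Dec (∀ a → P a)
∀? P? = map′ (λ all a → All.lookup all (∈-elements a))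
             (λ h → All.tabulate (λ {a} _ → h a))
             (all? P? elements)

M33-isLattice : IsLattice _≡_ _⊔_ _⊓_
M33-isLattice = record
  { isEquivalence = record { refl = refl ; sym = sym ; trans = trans }
  ; ∨-comm  = from-yes (∀? λ a → ∀? λ b → a ⊔ b ≟ b ⊔ a)
  ; ∨-assoc = from-yes (∀? λ a → ∀? λ b → ∀? λ c → (a ⊔ b) ⊔ c ≟ a ⊔ (b ⊔ c))
  ; ∨-cong  = cong₂ _⊔_
  ; ∧-comm  = from-yes (∀? λ a → ∀? λ b → a ⊓ b ≟ b ⊓ a)
  ; ∧-assoc = from-yes (∀? λ a → ∀? λ b → ∀? λ c → (a ⊓ b) ⊓ c ≟ a ⊓ (b ⊓ c))
  ; ∧-cong  = cong₂ _⊓_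
  ; absorptive = from-yes (∀? λ a → ∀? λ b → a ⊔ (a ⊓ b) ≟ a)
               , from-yes (∀? λ a → ∀? λ b → a ⊓ (a ⊔ b) ≟ a)
  }

module LatticeFacts (L : Lattice 0ℓ 0ℓ) where
  open Lattice L
  private
    module O = OrderTheoretic.Lattice
                 (LatticeProperties.∨-∧-orderTheoreticLattice L)

  infix 4 _≤_
  _≤_ : Carrier → Carrier → Set
  _≤_ = _≼_ L

  -- Our order x ∨ y ≈ y agrees with the library's order x ≈ x ∧ y, so the
  -- order-theoretic facts below are imported through this translation.
  to-O : ∀ {x y} → x ≤ y → x O.≤ y
  to-O {x} {y} x∨y≈y = begin
    x            ≈⟨ ∧-absorbs-∨ x y ⟨
    x ∧ (x ∨ y)  ≈⟨ ∧-congˡ x∨y≈y ⟩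
    x ∧ y        ∎
    where open import Relation.Binary.Reasoning.Setoid setoid

  from-O : ∀ {x y} → x O.≤ y → x ≤ y
  from-O {x} {y} x≈x∧y = begin
    x ∨ y        ≈⟨ ∨-congʳ x≈x∧y ⟩
    x ∧ y ∨ y    ≈⟨ ∨-comm _ y ⟩
    y ∨ x ∧ y    ≈⟨ ∨-congˡ (∧-comm x y) ⟩
    y ∨ y ∧ x    ≈⟨ ∨-absorbs-∧ y x ⟩
    y            ∎
    where open import Relation.Binary.Reasoning.Setoid setoid

  ≤-refl : ∀ {x} → x ≤ x
  ≤-refl = from-O O.refl

  ≤-trans : ∀ {x y z} → x ≤ y → y ≤ z → x ≤ z
  ≤-trans p q = from-O (O.trans (to-O p) (to-O q))

  ≤-antisym : ∀ {x y} → x ≤ y → y ≤ x → x ≈ y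
  ≤-antisym p q = O.antisym (to-O p) (to-O q)

  ≤-respˡ-≈ : ∀ {x y z} → x ≈ y → x ≤ z → y ≤ z
  ≤-respˡ-≈ x≈y p = from-O (O.≤-respˡ-≈ x≈y (to-O p))

  x≤x∨y : ∀ x y → x ≤ x ∨ y
  x≤x∨y x y = from-O (O.x≤x∨y x y)

  y≤x∨y : ∀ x y → y ≤ x ∨ y
  y≤x∨y x y = from-O (O.y≤x∨y x y)

  ∨-least : ∀ {x y z} → x ≤ z → y ≤ z → x ∨ y ≤ z
  ∨-least p q = from-O (O.∨-least (to-O p) (to-O q))

  x∧y≤x : ∀ x y → x ∧ y ≤ x
  x∧y≤x x y = from-O (O.x∧y≤x x y)

  x∧y≤y : ∀ x y → x ∧ y ≤ y
  x∧y≤y x y = from-O (O.x∧y≤y x y)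

  ∧-greatest : ∀ {x y z} → x ≤ y → x ≤ z → x ≤ y ∧ z
  ∧-greatest p q = from-O (O.∧-greatest (to-O p) (to-O q))

  ∨-mono : ∀ {x x′ y y′} → x ≤ x′ → y ≤ y′ → x ∨ y ≤ x′ ∨ y′
  ∨-mono p q = from-O (JoinProperties.∨-monotonic O.joinSemilattice (to-O p) (to-O q))

  ∧-mono : ∀ {x x′ y y′} → x ≤ x′ → y ≤ y′ → x ∧ y ≤ x′ ∧ y′
  ∧-mono p q = from-O (MeetProperties.∧-monotonic O.meetSemilattice (to-O p) (to-O q))

  evalL-mono : {X : Set} {ρ ρ′ : X → Carrier} → (∀ x → ρ x ≤ ρ′ x) →
               ∀ t → evalL L ρ t ≤ evalL L ρ′ t
  evalL-mono ρ≤ρ′ (var x)  = ρ≤ρ′ x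
  evalL-mono ρ≤ρ′ (s ∨ₜ t) = ∨-mono (evalL-mono ρ≤ρ′ s) (evalL-mono ρ≤ρ′ t)
  evalL-mono ρ≤ρ′ (s ∧ₜ t) = ∧-mono (evalL-mono ρ≤ρ′ s) (evalL-mono ρ≤ρ′ t)

  Increasing : (ℕ → Carrier) → Set
  Increasing s = ∀ n → s n ≤ s (suc n)

  increasing-mono : ∀ {s m n} → Increasing s → m ℕ.≤ n → s m ≤ s n
  increasing-mono {s} {m} inc m≤n = go (ℕ.≤⇒≤′ m≤n)
    where
    go : ∀ {n} → m ≤′ n → s m ≤ s n
    go ≤′-refl      = ≤-refl
    go (≤′-step m≤′n) = ≤-trans (go m≤′n) (inc _)

  ⋃↓ : (ℕ → Carrier) → Pred Carrier 0ℓ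
  ⋃↓ s z = Σ ℕ λ n → z ≤ s n

  common-stage : ∀ {s t a b} → Increasing s → Increasing t → ⋃↓ s a → ⋃↓ t b →
                 Σ ℕ λ n → a ≤ s n × b ≤ t n
  common-stage s-inc t-inc (m , a≤) (n , b≤) =
    m + n , ≤-trans a≤ (increasing-mono s-inc (ℕ.m≤m+n m n))
          , ≤-trans b≤ (increasing-mono t-inc (ℕ.m≤n+m n m))

  chainIdeal : ∀ {s} → Increasing s → Ideal L
  chainIdeal {s} inc = record
    { mem      = ⋃↓ s
    ; resp     = λ { x≈y (n , x≤) → n , ≤-respˡ-≈ x≈y x≤ }
    ; nonempty = s 0 , 0 , ≤-refl
    ; closed   = λ x y → mk⇔
        (λ { (n , x∨y≤) → (n , ≤-trans (x≤x∨y x y) x∨y≤) , (n , ≤-trans (y≤x∨y x y) x∨y≤) })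
        (λ { (x∈ , y∈) → let (n , x≤ , y≤) = common-stage inc inc x∈ y∈ in n , ∨-least x≤ y≤ })
    }

  evalId-⋃↓ : {X : Set} (env : X → Pred Carrier 0ℓ) (σ : ℕ → X → Carrier) →
              (∀ x → Increasing (λ n → σ n x)) → (∀ x → env x ≐ ⋃↓ (λ n → σ n x)) →
              ∀ t → evalId L env t ≐ ⋃↓ (λ n → evalL L (σ n) t)
  evalId-⋃↓ {X} env σ inc env≐ = go
    where
    stage : Term X → ℕ → Carrier
    stage t n = evalL L (σ n) t

    stage-inc : ∀ t → Increasing (stage t)
    stage-inc t n = evalL-mono (λ x → inc x n) t

    go : ∀ t → evalId L env t ≐ ⋃↓ (stage t)
    go (var x)  = env≐ x
    go (s ∨ₜ t) = to , from
      where
      to : ∀ {z} → evalId L env (s ∨ₜ t) z → ⋃↓ (stage (s ∨ₜ t)) z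
      to (a , b , a∈ , b∈ , z≤a∨b) =
        let (n , a≤ , b≤) = common-stage (stage-inc s) (stage-inc t)
                                         (proj₁ (go s) a∈) (proj₁ (go t) b∈)
        in n , ≤-trans z≤a∨b (∨-mono a≤ b≤)
      from : ∀ {z} → ⋃↓ (stage (s ∨ₜ t)) z → evalId L env (s ∨ₜ t) z
      from (n , z≤) = stage s n , stage t n
                    , proj₂ (go s) (n , ≤-refl) , proj₂ (go t) (n , ≤-refl) , z≤
    go (s ∧ₜ t) = to , from
      where
      to : ∀ {z} → evalId L env (s ∧ₜ t) z → ⋃↓ (stage (s ∧ₜ t)) z
      to (z∈s , z∈t) =
        let (n , z≤s , z≤t) = common-stage (stage-inc s) (stage-inc t)
                                           (proj₁ (go s) z∈s) (proj₁ (go t) z∈t)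
        in n , ∧-greatest z≤s z≤t
      from : ∀ {z} → ⋃↓ (stage (s ∧ₜ t)) z → evalId L env (s ∧ₜ t) z
      from (n , z≤) = proj₂ (go s) (n , ≤-trans z≤ (x∧y≤x _ _))
                    , proj₂ (go t) (n , ≤-trans z≤ (x∧y≤y _ _))

  ↓≐⋃↓-const : ∀ a → ↓ L a ≐ ⋃↓ (λ _ → a)
  ↓≐⋃↓-const a = (λ z≤a → 0 , z≤a) , proj₂

  evalId-↓ : {X : Set} (env : X → Pred Carrier 0ℓ) (ρ : X → Carrier) →
             (∀ x → env x ≐ ↓ L (ρ x)) → ∀ t → evalId L env t ≐ ↓ L (evalL L ρ t)
  evalId-↓ env ρ env≐ t =
    ≐-trans (evalId-⋃↓ env (λ _ → ρ) (λ _ _ → ≤-refl)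
                       (λ x → ≐-trans (env≐ x) (↓≐⋃↓-const (ρ x))) t)
            (≐-sym (↓≐⋃↓-const (evalL L ρ t)))

  ↓-injective : ∀ {a b} → ↓ L a ≐ ↓ L b → a ≈ b
  ↓-injective (a⊆b , b⊆a) = ≤-antisym (a⊆b ≤-refl) (b⊆a ≤-refl)

  Interleaved : (ℕ → Carrier) → (ℕ → Carrier) → Set
  Interleaved s t = (∀ n → s n ≤ t (suc n)) × (∀ n → t n ≤ s (suc n))

  ⋃↓-interleaved : ∀ {s t} → Interleaved s t → ⋃↓ s ≐ ⋃↓ t
  ⋃↓-interleaved (s≤t , t≤s) =
    (λ { (n , z≤) → suc n , ≤-trans z≤ (s≤t n) }) ,
    (λ { (n , z≤) → suc n , ≤-trans z≤ (t≤s n) })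

  stageAt : {n : ℕ} → (Fin n → ℕ → Carrier) → Term (Fin n ⊎ Carrier) → ℕ → Carrier
  stageAt s t k = evalL L [ (λ i → s i k) , id ] t

  solvable-by-chains : {n : ℕ} (sys : System L n) (s : Fin n → ℕ → Carrier) →
    (∀ i → Increasing (s i)) →
    All (λ eq → Interleaved (stageAt s (proj₁ eq)) (stageAt s (proj₂ eq))) sys →
    SolvableInId L sys
  solvable-by-chains sys s inc sides-interleave =
    (λ i → chainIdeal (inc i)) , All.map (λ {eq} → holds {eq}) sides-interleave
    where
    σ : ℕ → Fin _ ⊎ Carrier → Carrier
    σ k = [ (λ i → s i k) , id ]

    σ-inc : ∀ x → Increasing (λ k → σ k x)
    σ-inc (inj₁ i) = inc i
    σ-inc (inj₂ a) _ = ≤-refl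

    env≐ : ∀ x → [ (λ i → ⋃↓ (s i)) , ↓ L ] x ≐ ⋃↓ (λ k → σ k x)
    env≐ (inj₁ i) = ≐-refl
    env≐ (inj₂ a) = ↓≐⋃↓-const a

    holds : ∀ {eq} → Interleaved (stageAt s (proj₁ eq)) (stageAt s (proj₂ eq)) →
            evalId L [ (λ i → ⋃↓ (s i)) , ↓ L ] (proj₁ eq)
              ≐ evalId L [ (λ i → ⋃↓ (s i)) , ↓ L ] (proj₂ eq)
    holds {l , r} l⋈r =
      ≐-trans (evalId-⋃↓ _ σ σ-inc env≐ l)
              (≐-trans (⋃↓-interleaved l⋈r) (≐-sym (evalId-⋃↓ _ σ σ-inc env≐ r)))

  HoldsInL : {n : ℕ} → (Fin n → Carrier) → System L n → Set
  HoldsInL ρ = All (λ eq → evalL L [ ρ , id ] (proj₁ eq) ≈ evalL L [ ρ , id ] (proj₂ eq))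

  -- A solution of a system in the image of the canonical embedding is a
  -- solution in L itself, since x ↦ ↓x preserves terms and is injective.
  principal-solution : {n : ℕ} (sys : System L n) (ρ : Fin n → Carrier) →
    HoldsInId L (λ i → ↓ L (ρ i)) sys → HoldsInL ρ sys
  principal-solution sys ρ = All.map (λ {eq} → equal {eq})
    where
    env≐ : ∀ x → [ (λ i → ↓ L (ρ i)) , ↓ L ] x ≐ ↓ L ([ ρ , id ] x)
    env≐ (inj₁ i) = ≐-refl
    env≐ (inj₂ a) = ≐-refl

    equal : ∀ {eq} →
            evalId L [ (λ i → ↓ L (ρ i)) , ↓ L ] (proj₁ eq)
              ≐ evalId L [ (λ i → ↓ L (ρ i)) , ↓ L ] (proj₂ eq) →
            evalL L [ ρ , id ] (proj₁ eq) ≈ evalL L [ ρ , id ] (proj₂ eq)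
    equal {l , r} l≐r =
      ↓-injective (≐-trans (≐-sym (evalId-↓ _ _ env≐ l))
                           (≐-trans l≐r (evalId-↓ _ _ env≐ r)))

-- The lattice of eventually constant R-chains, for a sublattice R of M₃,₃²

module ChainLattice
  (R   : M33 → M33 → Set)
  (R-⊔ : ∀ {a b c d} → R a b → R c d → R (a ⊔ c) (b ⊔ d))
  (R-⊓ : ∀ {a b c d} → R a b → R c d → R (a ⊓ c) (b ⊓ d))
  where

  record Chain : Set where
    constructor chain
    field
      at      : ℕ → M33
      step    : ∀ k → R (at k) (at (suc k))
      settles : ℕ
      stable  : ∀ k → settles ℕ.≤ k → at (suc k) ≡ at k
  open Chain public

  pointwise : (_∙_ : M33 → M33 → M33) →
              (∀ {a b c d} → R a b → R c d → R (a ∙ c) (b ∙ d)) →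
              Chain → Chain → Chain
  pointwise _∙_ R-∙ x y = record
    { at      = λ k → at x k ∙ at y k
    ; step    = λ k → R-∙ (step x k) (step y k)
    ; settles = settles x + settles y
    ; stable  = λ k p → cong₂ _∙_
        (stable x k (ℕ.≤-trans (ℕ.m≤m+n (settles x) (settles y)) p))
        (stable y k (ℕ.≤-trans (ℕ.m≤n+m (settles y) (settles x)) p))
    }

  _≈ᶜ_ : Chain → Chain → Set
  x ≈ᶜ y = ∀ k → at x k ≡ at y k

  chains-isLattice : IsLattice _≈ᶜ_ (pointwise _⊔_ R-⊔) (pointwise _⊓_ R-⊓)
  chains-isLattice = record
    { isEquivalence = record
        { refl = λ k → refl ; sym = λ p k → sym (p k) ; trans = λ p q k → trans (p k) (q k) }
    ; ∨-comm  = λ x y k → M.∨-comm (at x k) (at y k)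
    ; ∨-assoc = λ x y z k → M.∨-assoc (at x k) (at y k) (at z k)
    ; ∨-cong  = λ p q k → cong₂ _⊔_ (p k) (q k)
    ; ∧-comm  = λ x y k → M.∧-comm (at x k) (at y k)
    ; ∧-assoc = λ x y z k → M.∧-assoc (at x k) (at y k) (at z k)
    ; ∧-cong  = λ p q k → cong₂ _⊓_ (p k) (q k)
    ; absorptive = (λ x y k → M.∨-absorbs-∧ (at x k) (at y k))
                 , (λ x y k → M.∧-absorbs-∨ (at x k) (at y k))
    }
    where module M = IsLattice M33-isLattice

  Chains : Lattice 0ℓ 0ℓ
  Chains = record { isLattice = chains-isLattice }

  evalL-at : ∀ (ρ : ℕ → Chain) t k → at (evalL Chains ρ t) k ≡ eval₃₃ (λ i → at (ρ i) k) t
  evalL-at ρ (var i)  k = refl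
  evalL-at ρ (s ∨ₜ t) k = cong₂ _⊔_ (evalL-at ρ s k) (evalL-at ρ t k)
  evalL-at ρ (s ∧ₜ t) k = cong₂ _⊓_ (evalL-at ρ s k) (evalL-at ρ t k)

  -- Being a sublattice of M₃,₃^ℕ, the lattice of chains lies in 𝓜₃,₃.
  chains-in-variety : InM33Variety Chains
  chains-in-variety s t s≡t ρ k =
    trans (evalL-at ρ s k) (trans (s≡t (λ i → at (ρ i) k)) (sym (evalL-at ρ t k)))

infix 4 _⊑_ _⊑?_
_⊑_ : M33 → M33 → Set
a ⊑ b = a ⊔ b ≡ b

_⊑?_ : ∀ a b → Dec (a ⊑ b)
a ⊑? b = a ⊔ b ≟ b

swap : M33 → M33
swap u₀ = u₁
swap u₁ = u₀
swap a  = a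

floor : M33 → M33
floor u₀ = u
floor u₁ = u
floor 𝟏  = u
floor _  = 𝟎

record R (a b : M33) : Set where
  constructor between
  field
    above-floor : floor a ⊑ b
    below-swap  : b ⊑ swap a

R? : ∀ a b → Dec (R a b)
R? a b = map′ (λ (p , q) → between p q) (λ (between p q) → p , q)
              (floor a ⊑? b ×-dec b ⊑? swap a)

R-⊔ : ∀ {a b c d} → R a b → R c d → R (a ⊔ c) (b ⊔ d)
R-⊔ {a} {b} {c} {d} = from-yes
  (∀? λ a → ∀? λ b → ∀? λ c → ∀? λ d →
     R? a b →-dec R? c d →-dec R? (a ⊔ c) (b ⊔ d)) a b c d

R-⊓ : ∀ {a b c d} → R a b → R c d → R (a ⊓ c) (b ⊓ d)
R-⊓ {a} {b} {c} {d} = from-yes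
  (∀? λ a → ∀? λ b → ∀? λ c → ∀? λ d →
     R? a b →-dec R? c d →-dec R? (a ⊓ c) (b ⊓ d)) a b c d

R-swap : ∀ {a b} → R a b → R (swap a) (swap b)
R-swap {a} {b} = from-yes (∀? λ a → ∀? λ b → R? a b →-dec R? (swap a) (swap b)) a b

UAtom : M33 → Set
UAtom a = a ≡ u₀ ⊎ a ≡ u₁

UAtom? : ∀ a → Dec (UAtom a)
UAtom? a = a ≟ u₀ ⊎-dec a ≟ u₁

-- R has no loop at u₀ or u₁: a chain can never settle on a side atom.
uatom-unstable : ∀ a → UAtom a → ¬ R a a
uatom-unstable = from-yes (∀? λ a → UAtom? a →-dec ¬? (R? a a))

-- At coordinate 0, where d = v and e = u, the three equations force x into
-- {u₀, u₁}.
uatom-start : ∀ a b → (a ⊔ v₀) ⊓ v₁ ≡ (a ⊔ b) ⊓ v₁ → v₀ ⊓ b ≡ b ⊓ v₁ → a ⊓ v ≡ u →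
              UAtom a
uatom-start = from-yes (∀? λ a → ∀? λ b →
  (a ⊔ v₀) ⊓ v₁ ≟ (a ⊔ b) ⊓ v₁ →-dec v₀ ⊓ b ≟ b ⊓ v₁ →-dec a ⊓ v ≟ u →-dec UAtom? a)

uatom-step : ∀ {a a′} → R a a′ → UAtom a → ∀ b′ →
             (a′ ⊔ v₀) ⊓ v₁ ≡ (a′ ⊔ b′) ⊓ v₁ → v₀ ⊓ b′ ≡ b′ ⊓ v₁ → UAtom a′
uatom-step {a} {a′} = from-yes (∀? λ a → ∀? λ a′ → R? a a′ →-dec UAtom? a →-dec ∀? λ b′ →
  (a′ ⊔ v₀) ⊓ v₁ ≟ (a′ ⊔ b′) ⊓ v₁ →-dec v₀ ⊓ b′ ≟ b′ ⊓ v₁ →-dec UAtom? a′) a a′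

-- A coordinate of the approximation xₙ₊₁ grows from that of xₙ: either the
-- latter is 0, or the former is a side atom above it.
Grows : M33 → M33 → Set
Grows a a′ = a ≡ 𝟎 ⊎ (a ⊑ a′ × UAtom a′)

Grows? : ∀ a a′ → Dec (Grows a a′)
Grows? a a′ = a ≟ 𝟎 ⊎-dec (a ⊑? a′ ×-dec UAtom? a′)

-- Growing coordinates of x and y = swap x increase, and along them each side
-- of the first two equations is bounded by the other side at the next stage.
grows-x : ∀ {a a′} → Grows a a′ → a ⊑ a′
grows-x {a} {a′} = from-yes (∀? λ a → ∀? λ a′ → Grows? a a′ →-dec a ⊑? a′) a a′

grows-y : ∀ {a a′} → Grows a a′ → swap a ⊑ swap a′
grows-y {a} {a′} = from-yes (∀? λ a → ∀? λ a′ → Grows? a a′ →-dec swap a ⊑? swap a′) a a′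

grows-eq₁ : ∀ {a a′} → Grows a a′ →
  ((a ⊔ v₀) ⊓ v₁ ⊑ (a′ ⊔ swap a′) ⊓ v₁) × ((a ⊔ swap a) ⊓ v₁ ⊑ (a′ ⊔ v₀) ⊓ v₁)
grows-eq₁ {a} {a′} = from-yes (∀? λ a → ∀? λ a′ → Grows? a a′ →-dec
  ((a ⊔ v₀) ⊓ v₁ ⊑? (a′ ⊔ swap a′) ⊓ v₁) ×-dec ((a ⊔ swap a) ⊓ v₁ ⊑? (a′ ⊔ v₀) ⊓ v₁)) a a′

grows-eq₂ : ∀ {a a′} → Grows a a′ →
  (v₀ ⊓ swap a ⊑ swap a′ ⊓ v₁) × (swap a ⊓ v₁ ⊑ v₀ ⊓ swap a′)
grows-eq₂ {a} {a′} = from-yes (∀? λ a → ∀? λ a′ → Grows? a a′ →-dec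
  (v₀ ⊓ swap a ⊑? swap a′ ⊓ v₁) ×-dec (swap a ⊓ v₁ ⊑? v₀ ⊓ swap a′)) a a′

-- 0 is the bottom element (beyond coordinate 0 the parameters d, e are 0).
⊓-zero : ∀ a → a ⊓ 𝟎 ≡ 𝟎
⊓-zero = from-yes (∀? λ a → a ⊓ 𝟎 ≟ 𝟎)

open ChainLattice R R-⊔ R-⊓
open LatticeFacts Chains
  using (Increasing; solvable-by-chains; HoldsInL; principal-solution)

constant : (a : M33) → R a a → Chain
constant a r = chain (λ _ → a) (λ _ → r) 0 (λ _ _ → refl)

pulse : (a : M33) → R a 𝟎 → Chain
pulse a r = chain at′ step′ 1 stable′
  where
  at′ : ℕ → M33
  at′ zero    = a
  at′ (suc _) = 𝟎
  step′ : ∀ k → R (at′ k) (at′ (suc k))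
  step′ zero    = r
  step′ (suc _) = between refl refl
  stable′ : ∀ k → 1 ℕ.≤ k → at′ (suc k) ≡ at′ k
  stable′ (suc _) _ = refl

c₀ c₁ d e : Chain
c₀ = constant v₀ (between refl refl)
c₁ = constant v₁ (between refl refl)
d  = pulse v (between refl refl)
e  = pulse u (between refl refl)

X Y : Term (Fin 2 ⊎ Chain)
X = var (inj₁ fzero)
Y = var (inj₁ (fsuc fzero))

param : Chain → Term (Fin 2 ⊎ Chain)
param = var ∘ inj₂

system : System Chains 2
system = ((X ∨ₜ param c₀) ∧ₜ param c₁ , (X ∨ₜ Y) ∧ₜ param c₁)
       ∷ (param c₀ ∧ₜ Y , Y ∧ₜ param c₁)
       ∷ (X ∧ₜ param d , param e)
       ∷ []

-- zigzag n = (u₀ u₁)ⁿ⁺¹ u 0 0 …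
zigzag : ℕ → ℕ → M33
zigzag n       zero                = u₀
zigzag n       (suc zero)          = u₁
zigzag zero    (suc (suc zero))    = u
zigzag zero    (suc (suc (suc k))) = 𝟎
zigzag (suc n) (suc (suc k))       = zigzag n k

zigzag-settles : ℕ → ℕ
zigzag-settles zero    = 3
zigzag-settles (suc n) = 2 + zigzag-settles n

zigzag-step : ∀ n k → R (zigzag n k) (zigzag n (suc k))
zigzag-step n       zero                = between refl refl
zigzag-step zero    (suc zero)          = between refl refl
zigzag-step (suc n) (suc zero)          = between refl refl
zigzag-step zero    (suc (suc zero))    = between refl refl
zigzag-step zero    (suc (suc (suc k))) = between refl refl
zigzag-step (suc n) (suc (suc k))       = zigzag-step n k

zigzag-stable : ∀ n k → zigzag-settles n ℕ.≤ k → zigzag n (suc k) ≡ zigzag n k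
zigzag-stable zero    (suc zero)          (s≤s ())
zigzag-stable zero    (suc (suc zero))    (s≤s (s≤s ()))
zigzag-stable zero    (suc (suc (suc k))) _                 = refl
zigzag-stable (suc n) (suc (suc k))       (s≤s (s≤s n≤k)) = zigzag-stable n k n≤k

zigzag-grows : ∀ n k → Grows (zigzag n k) (zigzag (suc n) k)
zigzag-grows n       zero                      = inj₂ (refl , inj₁ refl)
zigzag-grows n       (suc zero)                = inj₂ (refl , inj₂ refl)
zigzag-grows zero    (suc (suc zero))          = inj₂ (refl , inj₁ refl)
zigzag-grows zero    (suc (suc (suc k)))       = inj₁ refl
zigzag-grows (suc n) (suc (suc k))             = zigzag-grows n k

approx : Fin 2 → ℕ → Chain
approx fzero        n = chain (zigzag n) (zigzag-step n) (zigzag-settles n) (zigzag-stable n)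
approx (fsuc fzero) n = chain (swap ∘ zigzag n) (R-swap ∘ zigzag-step n) (zigzag-settles n)
                              (λ k p → cong swap (zigzag-stable n k p))

approx-increasing : ∀ i → Increasing (approx i)
approx-increasing fzero        n k = grows-x (zigzag-grows n k)
approx-increasing (fsuc fzero) n k = grows-y (zigzag-grows n k)

system-solvable-in-Id : SolvableInId Chains system
system-solvable-in-Id = solvable-by-chains system approx approx-increasing
  ( ((λ n k → proj₁ (grows-eq₁ (zigzag-grows n k))) ,
     (λ n k → proj₂ (grows-eq₁ (zigzag-grows n k))))
  ∷ ((λ n k → proj₁ (grows-eq₂ (zigzag-grows n k))) ,
     (λ n k → proj₂ (grows-eq₂ (zigzag-grows n k))))
  ∷ (eq₃-up , eq₃-down)
  ∷ [] )
  where
  -- X ∧ d and e agree at every stage: both are u at coordinate 0 and 0 beyond.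
  eq₃-up : ∀ n k → (zigzag n k ⊓ at d k) ⊔ at e k ≡ at e k
  eq₃-up n zero    = refl
  eq₃-up n (suc k) = cong (_⊔ 𝟎) (⊓-zero (zigzag n (suc k)))

  eq₃-down : ∀ n k → at e k ⊔ (zigzag (suc n) k ⊓ at d k) ≡ zigzag (suc n) k ⊓ at d k
  eq₃-down n zero    = refl
  eq₃-down n (suc k) = refl

no-solution-in-M : (ρ : Fin 2 → Chain) → ¬ HoldsInId Chains (λ i → ↓ Chains (ρ i)) system
no-solution-in-M ρ holds = refute (principal-solution system ρ holds)
  where
  x y : Chain
  x = ρ fzero
  y = ρ (fsuc fzero)

  N : ℕ
  N = settles x

  -- x settles, so its last step is a loop of R.
  loop : R (at x N) (at x N)
  loop = subst (R (at x N)) (stable x N ℕ.≤-refl) (step x N)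

  refute : HoldsInL ρ system → ⊥
  refute (eq₁ ∷ eq₂ ∷ eq₃ ∷ []) = uatom-unstable (at x N) (on-side-atom N) loop
    where
    on-side-atom : ∀ k → UAtom (at x k)
    on-side-atom zero    = uatom-start (at x 0) (at y 0) (eq₁ 0) (eq₂ 0) (eq₃ 0)
    on-side-atom (suc k) =
      uatom-step (step x k) (on-side-atom k) (at y (suc k)) (eq₁ (suc k)) (eq₂ (suc k))

theorem5p5 : Σ (Lattice 0ℓ 0ℓ) λ M → InM33Variety M × ¬ CanonicalEmbeddingPure M
theorem5p5 = Chains , chains-in-variety , not-pure
  where
  not-pure : ¬ CanonicalEmbeddingPure Chains
  not-pure pure = let (ρ , holds) = pure 2 system system-solvable-in-Id
                  in no-solution-in-M ρ holds
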